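{- For each even integer $t \ge 4$ define \begin{align*} U_t(x) &= 2x^{2t-1} + x^{t+3} - x^{t+2} + x^{t+1} - 3x^t + 3x^{t-1} - x^{t-2} + x^{t-3} - x^{t-4} - 2,\\ W_t(x) &= 2x^{2t-1} - x^{t+3} + x^{t+2} - x^{t+1} - x^t + x^{t-1} + x^{t-2} - x^{t-3} + x^{t-4} - 2. \end{align*} For each even $t \ge 4$, neither $U_t(x)$ nor $W_t(x)$ is divisible by $\Phi_b(x)$ for any integer $b \ge 3$ such that: all prime factors of $b$ lie in $\{2, 3, 5, 7\}$; $b$ is not divisible by all of $3, 5, 7$; and $2^2 \nmid b$, $3^3 \nmid b$, $5^3 \nmid b$, $7^2 \nmid b$.
   Context: $\Phi_b(x)$ denotes the $b$-th cyclotomic polynomial, $\Phi_b(x) = \prod_\xi (x - \xi)$ with $\xi$ ranging over the primitive $b$-th roots of unity; divisibility is in $\mathbb{Q}[x]$. -}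

module Defs where

open import Data.Nat as ℕ using (ℕ; zero; suc; _∸_; _≤?_; _≟_)
open import Data.Nat.Divisibility using (_∣?_)
open import Data.Integer as ℤ using (ℤ; +_; -[1+_])
open import Data.Rational as ℚ using (ℚ; 0ℚ; 1ℚ; _/_)
open import Data.List using (List; []; _∷_; replicate; _++_; reverse; length; foldr; map; upTo; filter)
open import Data.Product using (∃)
open import Relation.Nullary using (does)
open import Relation.Binary.PropositionalEquality using (_≡_)
open import Data.Bool using (if_then_else_)

-- Polynomials over ℚ as coefficient lists, lowest degree first.
Poly : Set
Poly = List ℚ

coeff : Poly → ℕ → ℚ
coeff []       _       = 0ℚ
coeff (a ∷ p)  zero    = a
coeff (a ∷ p)  (suc i) = coeff p i

infixl 6 _+ₚ_
infixl 7 _*ₚ_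

_+ₚ_ : Poly → Poly → Poly
[]      +ₚ q       = q
(a ∷ p) +ₚ []      = a ∷ p
(a ∷ p) +ₚ (b ∷ q) = (a ℚ.+ b) ∷ (p +ₚ q)

_*ₚ_ : Poly → Poly → Poly
[]      *ₚ q = []
(a ∷ p) *ₚ q = map (a ℚ.*_) q +ₚ (0ℚ ∷ (p *ₚ q))

-- divisibility in ℚ[x]; equality of polynomials is coefficientwise
-- (so trailing zero coefficients are irrelevant)
_∣ₚ_ : Poly → Poly → Set
P ∣ₚ Q = ∃ λ (R : Poly) → ∀ i → coeff Q i ≡ coeff (P *ₚ R) i

ι : ℤ → ℚ
ι z = z / 1

mono : ℤ → ℕ → Poly
mono c k = replicate k 0ℚ ++ (ι c ∷ [])

sumₚ : List Poly → Poly
sumₚ = foldr _+ₚ_ []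

prodₚ : List Poly → Poly
prodₚ = foldr _*ₚ_ (1ℚ ∷ [])

-- Exact long division by a monic polynomial (used to define Φ_n).
-- Working with highest-degree-first lists.

private
  subFront : ℚ → List ℚ → List ℚ → List ℚ
  subFront c []       ns       = ns
  subFront c (d ∷ ds) []       = []
  subFront c (d ∷ ds) (n ∷ ns) = (n ℚ.- c ℚ.* d) ∷ subFront c ds ns

  divH : ℕ → List ℚ → List ℚ → List ℚ
  divH zero    ds ns       = []
  divH (suc k) ds []       = []
  divH (suc k) ds (n ∷ ns) = n ∷ divH k ds (subFront n ds ns)

-- quotient of N by a monic D (D given lowest-degree first, leading coefficient 1
-- as its last entry)
divMonic : Poly → Poly → Poly
divMonic N D with reverse D
... | []       = []
... | (_ ∷ ds) = reverse (divH (length N ∸ length ds) ds (reverse N))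

xⁿ-1 : ℕ → Poly
xⁿ-1 n = mono (-[1+ 0 ]) 0 +ₚ mono (+ 1) n

properDivisors : ℕ → List ℕ
properDivisors n = filter (λ d → d ∣? n) (Data.List.drop 1 (upTo n))
  where import Data.List

-- table n d = Φ_d for 1 ≤ d ≤ n, defined by the standard recursion
--   Φ_n(x) = (x^n - 1) / ∏_{d ∣ n, d < n} Φ_d(x).
table : ℕ → ℕ → Poly
table zero    d = 1ℚ ∷ []
table (suc n) d =
  if does (d ℕ.≤? n) then table n d
  else (if does (d ≟ suc n)
        then divMonic (xⁿ-1 (suc n)) (prodₚ (map (table n) (properDivisors (suc n))))
        else 1ℚ ∷ [])

Φ : ℕ → Poly
Φ b = table b b

-- The polynomials U_t and W_t (for t ≥ 4; exponents use truncated ∸,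
-- which is exact in that range).

U : ℕ → Poly
U t = sumₚ
  ( mono (+ 2) (2 ℕ.* t ∸ 1)
  ∷ mono (+ 1) (t ℕ.+ 3)
  ∷ mono (-[1+ 0 ]) (t ℕ.+ 2)
  ∷ mono (+ 1) (t ℕ.+ 1)
  ∷ mono (-[1+ 2 ]) t
  ∷ mono (+ 3) (t ∸ 1)
  ∷ mono (-[1+ 0 ]) (t ∸ 2)
  ∷ mono (+ 1) (t ∸ 3)
  ∷ mono (-[1+ 0 ]) (t ∸ 4)
  ∷ mono (-[1+ 1 ]) 0
  ∷ [])

W : ℕ → Poly
W t = sumₚ
  ( mono (+ 2) (2 ℕ.* t ∸ 1)
  ∷ mono (-[1+ 0 ]) (t ℕ.+ 3)
  ∷ mono (+ 1) (t ℕ.+ 2)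
  ∷ mono (-[1+ 0 ]) (t ℕ.+ 1)
  ∷ mono (-[1+ 0 ]) t
  ∷ mono (+ 1) (t ∸ 1)
  ∷ mono (+ 1) (t ∸ 2)
  ∷ mono (-[1+ 0 ]) (t ∸ 3)
  ∷ mono (+ 1) (t ∸ 4)
  ∷ mono (-[1+ 1 ]) 0
  ∷ [])

{-# OPTIONS --safe #-}
module Submission where

-- Φ_b has integer coefficients and constant term 1, so a factorisation U_t = Φ_b · R in ℚ[x]
-- can be unwound from the constant term upwards with every partial dividend integral; hence
-- p ∣ Φ_b(α) implies p ∣ U_t(α) for all integers p and α.  Writing t = 4 + s,
-- U_t(α) = 2α⁷(αˢ)² + B_U(α)αˢ − 2, so once α^b ≡ 1 (mod p) the residue of U_t(α) only depends
-- on s modulo 2b.  The hypotheses force b to be a divisor of 3150 = 2·3²·5²·7 other than 1, 2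
-- and the multiples of 105; for each of these 26 values a pair (p, α) with p ∣ Φ_b(α) and
-- α^b ≡ 1 is exhibited for which all these residues of U_t(α), and likewise of W_t(α), are
-- nonzero.

open import Defs
open import Data.Nat as ℕ using (ℕ; zero; suc)
open import Data.Integer as ℤ using (ℤ; +_; -[1+_]; 0ℤ; 1ℤ)
open import Data.Rational as ℚ using (0ℚ; 1ℚ)
import Data.Rational.Properties as ℚP
import Data.Integer.Properties as ℤP
open import Data.List using (List; []; _∷_; map)
open import Data.Product using (_×_; _,_)
open import Relation.Binary.PropositionalEquality
  using (_≡_; refl; sym; trans; cong; cong₂; subst; module ≡-Reasoning)

module Embedding where

  open import Data.Nat.Coprimality using (1-coprimeTo) renaming (sym to coprime-sym)

  private
    ι≡mkℚ : ∀ z → ι z ≡ ℚ.mkℚ z 0 (coprime-sym (1-coprimeTo ℤ.∣ z ∣))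
    ι≡mkℚ (+ n)    = ℚP.normalize-coprime (coprime-sym (1-coprimeTo n))
    ι≡mkℚ -[1+ n ] = cong ℚ.-_ (ℚP.normalize-coprime (coprime-sym (1-coprimeTo (suc n))))

  ι-+ : ∀ a b → ι (a ℤ.+ b) ≡ ι a ℚ.+ ι b
  ι-+ a b rewrite ι≡mkℚ a | ι≡mkℚ b =
    cong ι (sym (cong₂ ℤ._+_ (ℤP.*-identityʳ a) (ℤP.*-identityʳ b)))

  ι-* : ∀ a b → ι (a ℤ.* b) ≡ ι a ℚ.* ι b
  ι-* a b rewrite ι≡mkℚ a | ι≡mkℚ b = refl

  ι-neg : ∀ a → ι (ℤ.- a) ≡ ℚ.- ι a
  ι-neg a rewrite ι≡mkℚ a | ι≡mkℚ (ℤ.- a) with a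
  ... | + zero   = refl
  ... | + suc n  = refl
  ... | -[1+ n ] = refl

  ι-injective : ∀ {a b} → ι a ≡ ι b → a ≡ b
  ι-injective {a} {b} eq rewrite ι≡mkℚ a | ι≡mkℚ b = cong ℚ.↥_ eq

module Coefficients where

  open import Data.Rational using (_+_; _*_)
  open import Algebra.Bundles using (CommutativeMonoid)
  open import Algebra.Properties.CommutativeSemigroup
    (CommutativeMonoid.commutativeSemigroup ℚP.+-0-commutativeMonoid) using (x∙yz≈y∙xz)

  infix 4 _≈ₚ_
  _≈ₚ_ : Poly → Poly → Set
  P ≈ₚ Q = ∀ i → coeff P i ≡ coeff Q i

  coeff-+ₚ : ∀ P Q i → coeff (P +ₚ Q) i ≡ coeff P i + coeff Q i
  coeff-+ₚ []      Q       i       = sym (ℚP.+-identityˡ _)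
  coeff-+ₚ (a ∷ P) []      i       = sym (ℚP.+-identityʳ _)
  coeff-+ₚ (a ∷ P) (b ∷ Q) zero    = refl
  coeff-+ₚ (a ∷ P) (b ∷ Q) (suc i) = coeff-+ₚ P Q i

  coeff-map-* : ∀ a Q i → coeff (map (a *_) Q) i ≡ a * coeff Q i
  coeff-map-* a []      i       = sym (ℚP.*-zeroʳ a)
  coeff-map-* a (b ∷ Q) zero    = refl
  coeff-map-* a (b ∷ Q) (suc i) = coeff-map-* a Q i

  coeff-*ₚ-[] : ∀ P i → coeff (P *ₚ []) i ≡ 0ℚ
  coeff-*ₚ-[] []      i       = refl
  coeff-*ₚ-[] (a ∷ P) zero    = refl
  coeff-*ₚ-[] (a ∷ P) (suc i) = coeff-*ₚ-[] P i

  coeff-*ₚ-∷ : ∀ P r R i → coeff (P *ₚ (r ∷ R)) i ≡ r * coeff P i + coeff (0ℚ ∷ P *ₚ R) i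
  coeff-*ₚ-∷ []      r R zero    =
    sym (trans (cong (_+ 0ℚ) (ℚP.*-zeroʳ r)) (ℚP.+-identityʳ 0ℚ))
  coeff-*ₚ-∷ []      r R (suc i) =
    sym (trans (cong (_+ coeff ([] *ₚ R) i) (ℚP.*-zeroʳ r)) (ℚP.+-identityˡ _))
  coeff-*ₚ-∷ (a ∷ P) r R zero    = cong (_+ 0ℚ) (ℚP.*-comm a r)
  coeff-*ₚ-∷ (a ∷ P) r R (suc i) = begin
    coeff (map (a *_) R +ₚ P *ₚ (r ∷ R)) i
      ≡⟨ coeff-+ₚ (map (a *_) R) _ i ⟩
    coeff (map (a *_) R) i + coeff (P *ₚ (r ∷ R)) i
      ≡⟨ cong₂ _+_ (coeff-map-* a R i) (coeff-*ₚ-∷ P r R i) ⟩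
    a * coeff R i + (r * coeff P i + coeff (0ℚ ∷ P *ₚ R) i)
      ≡⟨ x∙yz≈y∙xz (a * coeff R i) (r * coeff P i) _ ⟩
    r * coeff P i + (a * coeff R i + coeff (0ℚ ∷ P *ₚ R) i)
      ≡⟨ cong (λ x → r * coeff P i + (x + coeff (0ℚ ∷ P *ₚ R) i)) (coeff-map-* a R i) ⟨
    r * coeff P i + (coeff (map (a *_) R) i + coeff (0ℚ ∷ P *ₚ R) i)
      ≡⟨ cong (_+_ (r * coeff P i)) (coeff-+ₚ (map (a *_) R) (0ℚ ∷ P *ₚ R) i) ⟨
    r * coeff P i + coeff (map (a *_) R +ₚ (0ℚ ∷ P *ₚ R)) i ∎
    where open ≡-Reasoning

module IntegerPolynomials where

  open Embedding
  open Coefficients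
  open import Data.Integer using (_+_; _*_; -_)
  open import Data.Integer.Divisibility.Signed using (_∣_; divides; ∣m∣n⇒∣m+n; ∣n⇒∣m*n)
  open import Data.List.Properties using (map-∘; map-cong)
  open import Algebra.Properties.AbelianGroup ℚP.+-0-abelianGroup using (xyx⁻¹≈y)
  open import Data.Integer.Tactic.RingSolver using (solve-∀)

  infixl 6 _+ᶻ_
  _+ᶻ_ : List ℤ → List ℤ → List ℤ
  []      +ᶻ Q       = Q
  (a ∷ P) +ᶻ []      = a ∷ P
  (a ∷ P) +ᶻ (b ∷ Q) = (a + b) ∷ (P +ᶻ Q)

  embed : List ℤ → Poly
  embed = map ι

  eval : List ℤ → ℤ → ℤ
  eval []      α = 0ℤ
  eval (a ∷ P) α = a + α * eval P α

  embed-+ᶻ : ∀ P Q → embed (P +ᶻ Q) ≡ embed P +ₚ embed Q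
  embed-+ᶻ []      Q       = refl
  embed-+ᶻ (a ∷ P) []      = refl
  embed-+ᶻ (a ∷ P) (b ∷ Q) = cong₂ _∷_ (ι-+ a b) (embed-+ᶻ P Q)

  embed-map-* : ∀ c P → embed (map (c *_) P) ≡ map (ι c ℚ.*_) (embed P)
  embed-map-* c P = trans (sym (map-∘ P)) (trans (map-cong (ι-* c) P) (map-∘ P))

  eval-+ᶻ : ∀ P Q α → eval (P +ᶻ Q) α ≡ eval P α + eval Q α
  eval-+ᶻ []      Q       α = sym (ℤP.+-identityˡ _)
  eval-+ᶻ (a ∷ P) []      α = sym (ℤP.+-identityʳ _)
  eval-+ᶻ (a ∷ P) (b ∷ Q) α rewrite eval-+ᶻ P Q α = lemma a b α (eval P α) (eval Q α)
    where
    lemma : ∀ a b α x y → a + b + α * (x + y) ≡ a + α * x + (b + α * y)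
    lemma = solve-∀

  eval-map-* : ∀ c P α → eval (map (c *_) P) α ≡ c * eval P α
  eval-map-* c []      α = sym (ℤP.*-zeroʳ c)
  eval-map-* c (b ∷ P) α rewrite eval-map-* c P α = lemma c b α (eval P α)
    where
    lemma : ∀ c b α x → c * b + α * (c * x) ≡ c * (b + α * x)
    lemma = solve-∀

  eval-≈ₚ[] : ∀ Q α → embed Q ≈ₚ [] → eval Q α ≡ 0ℤ
  eval-≈ₚ[] []      α Q≈0 = refl
  eval-≈ₚ[] (q ∷ Q) α Q≈0
    rewrite ι-injective {q} {0ℤ} (Q≈0 zero) | eval-≈ₚ[] Q α (λ i → Q≈0 (suc i)) =
    trans (ℤP.+-identityˡ _) (ℤP.*-zeroʳ α)

  quotient-step : ∀ P′ q Q r R →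
    embed (q ∷ Q) ≈ₚ embed (1ℤ ∷ P′) *ₚ (r ∷ R) →
    embed (Q +ᶻ map ((- q) *_) P′) ≈ₚ embed (1ℤ ∷ P′) *ₚ R
  quotient-step P′ q Q r R Q≈PR i = begin
    coeff (embed (Q +ᶻ map ((- q) *_) P′)) i
      ≡⟨ cong (λ A → coeff A i) (embed-+ᶻ Q _) ⟩
    coeff (embed Q +ₚ embed (map ((- q) *_) P′)) i
      ≡⟨ coeff-+ₚ (embed Q) _ i ⟩
    coeff (embed Q) i ℚ.+ coeff (embed (map ((- q) *_) P′)) i
      ≡⟨ cong (λ A → coeff (embed Q) i ℚ.+ coeff A i) (embed-map-* (- q) P′) ⟩
    coeff (embed Q) i ℚ.+ coeff (map (ι (- q) ℚ.*_) (embed P′)) i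
      ≡⟨ cong (coeff (embed Q) i ℚ.+_) (coeff-map-* (ι (- q)) (embed P′) i) ⟩
    coeff (embed Q) i ℚ.+ ι (- q) ℚ.* c
      ≡⟨ cong₂ ℚ._+_ (trans (Q≈PR (suc i)) (coeff-*ₚ-∷ P r R (suc i))) (cong (ℚ._* c) (ι-neg q)) ⟩
    r ℚ.* c ℚ.+ coeff (P *ₚ R) i ℚ.+ ℚ.- ι q ℚ.* c
      ≡⟨ cong₂ (λ x y → x ℚ.* c ℚ.+ coeff (P *ₚ R) i ℚ.+ y) r≡ιq (sym (ℚP.neg-distribˡ-* (ι q) c)) ⟩
    ι q ℚ.* c ℚ.+ coeff (P *ₚ R) i ℚ.+ ℚ.- (ι q ℚ.* c)
      ≡⟨ xyx⁻¹≈y (ι q ℚ.* c) _ ⟩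
    coeff (P *ₚ R) i ∎
    where
    open ≡-Reasoning
    P = embed (1ℤ ∷ P′)
    c = coeff (embed P′) i
    r≡ιq : r ≡ ι q
    r≡ιq = sym (begin
      ι q                     ≡⟨ Q≈PR zero ⟩
      coeff (P *ₚ (r ∷ R)) 0  ≡⟨ coeff-*ₚ-∷ P r R 0 ⟩
      r ℚ.* 1ℚ ℚ.+ 0ℚ         ≡⟨ ℚP.+-identityʳ _ ⟩
      r ℚ.* 1ℚ                ≡⟨ ℚP.*-identityʳ r ⟩
      r                       ∎)

  eval-step : ∀ P′ q Q α →
    eval (q ∷ Q) α ≡ q * eval (1ℤ ∷ P′) α + α * eval (Q +ᶻ map ((- q) *_) P′) α
  eval-step P′ q Q α rewrite eval-+ᶻ Q (map ((- q) *_) P′) α | eval-map-* (- q) P′ α =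
    lemma q α (eval Q α) (eval P′ α)
    where
    lemma : ∀ q α x y → q + α * x ≡ q * (1ℤ + α * y) + α * (x + - q * y)
    lemma = solve-∀

  ∣ₚ⇒∣eval : ∀ {p α} P′ Q → p ∣ eval (1ℤ ∷ P′) α → embed (1ℤ ∷ P′) ∣ₚ embed Q → p ∣ eval Q α
  ∣ₚ⇒∣eval {p} {α} P′ Q p∣P[α] (R , Q≈PR) = go R Q Q≈PR
    where
    p∣0 : p ∣ 0ℤ
    p∣0 = divides 0ℤ (sym (ℤP.*-zeroˡ p))
    go : ∀ R Q → embed Q ≈ₚ embed (1ℤ ∷ P′) *ₚ R → p ∣ eval Q α
    go []      Q       Q≈0  = subst (p ∣_) (sym (eval-≈ₚ[] Q α Q≈[])) p∣0
      where
      Q≈[] : embed Q ≈ₚ []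
      Q≈[] i = trans (Q≈0 i) (coeff-*ₚ-[] (embed (1ℤ ∷ P′)) i)
    go (r ∷ R) []      _    = p∣0
    go (r ∷ R) (q ∷ Q) Q≈PR = subst (p ∣_) (sym (eval-step P′ q Q α))
      (∣m∣n⇒∣m+n (∣n⇒∣m*n q p∣P[α]) (∣n⇒∣m*n α p∣Q′[α]))
      where
      p∣Q′[α] : p ∣ eval (Q +ᶻ map ((- q) *_) P′) α
      p∣Q′[α] = go R (Q +ᶻ map ((- q) *_) P′) (quotient-step P′ q Q r R Q≈PR)

module ClosedForms where

  open IntegerPolynomials
  open import Data.Nat using (_∸_)
  import Data.Nat.Properties as ℕP
  open import Data.Integer using (_+_; _*_; -_; _-_; _^_; -1ℤ)
  open import Data.List using (foldr; replicate; _++_)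
  open import Data.Product using (uncurry)
  open import Data.Integer.Tactic.RingSolver using (solve-∀)
  import Data.Nat.Tactic.RingSolver as ℕ-Solver

  monoᶻ : ℤ → ℕ → List ℤ
  monoᶻ c k = replicate k 0ℤ ++ (c ∷ [])

  sumᶻ : List (List ℤ) → List ℤ
  sumᶻ = foldr _+ᶻ_ []

  polyᶻ : List (ℤ × ℕ) → List ℤ
  polyᶻ cs = sumᶻ (map (uncurry monoᶻ) cs)

  evalTerms : List (ℤ × ℕ) → ℤ → ℤ
  evalTerms cs α = foldr (λ (c , k) acc → c * α ^ k + acc) 0ℤ cs

  embed-monoᶻ : ∀ c k → embed (monoᶻ c k) ≡ mono c k
  embed-monoᶻ c zero    = refl
  embed-monoᶻ c (suc k) = cong (0ℚ ∷_) (embed-monoᶻ c k)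

  embed-polyᶻ : ∀ cs → embed (polyᶻ cs) ≡ sumₚ (map (uncurry mono) cs)
  embed-polyᶻ []             = refl
  embed-polyᶻ ((c , k) ∷ cs) =
    trans (embed-+ᶻ (monoᶻ c k) (polyᶻ cs)) (cong₂ _+ₚ_ (embed-monoᶻ c k) (embed-polyᶻ cs))

  eval-monoᶻ : ∀ c k α → eval (monoᶻ c k) α ≡ c * α ^ k
  eval-monoᶻ c zero    α =
    trans (cong (_+_ c) (ℤP.*-zeroʳ α)) (trans (ℤP.+-identityʳ c) (sym (ℤP.*-identityʳ c)))
  eval-monoᶻ c (suc k) α rewrite eval-monoᶻ c k α = lemma α c (α ^ k)
    where
    lemma : ∀ α c x → 0ℤ + α * (c * x) ≡ c * (α * x)
    lemma = solve-∀

  eval-polyᶻ : ∀ cs α → eval (polyᶻ cs) α ≡ evalTerms cs α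
  eval-polyᶻ []             α = refl
  eval-polyᶻ ((c , k) ∷ cs) α =
    trans (eval-+ᶻ (monoᶻ c k) (polyᶻ cs) α) (cong₂ _+_ (eval-monoᶻ c k α) (eval-polyᶻ cs α))

  termsU termsW : ℕ → List (ℤ × ℕ)
  termsU t = (+ 2 , 2 ℕ.* t ∸ 1) ∷ (1ℤ , t ℕ.+ 3) ∷ (-1ℤ , t ℕ.+ 2) ∷ (1ℤ , t ℕ.+ 1)
           ∷ (-[1+ 2 ] , t) ∷ (+ 3 , t ∸ 1) ∷ (-1ℤ , t ∸ 2) ∷ (1ℤ , t ∸ 3) ∷ (-1ℤ , t ∸ 4)
           ∷ (-[1+ 1 ] , 0) ∷ []
  termsW t = (+ 2 , 2 ℕ.* t ∸ 1) ∷ (-1ℤ , t ℕ.+ 3) ∷ (1ℤ , t ℕ.+ 2) ∷ (-1ℤ , t ℕ.+ 1)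
           ∷ (-1ℤ , t) ∷ (1ℤ , t ∸ 1) ∷ (1ℤ , t ∸ 2) ∷ (-1ℤ , t ∸ 3) ∷ (1ℤ , t ∸ 4)
           ∷ (-[1+ 1 ] , 0) ∷ []

  Uᶻ Wᶻ : ℕ → List ℤ
  Uᶻ t = polyᶻ (termsU t)
  Wᶻ t = polyᶻ (termsW t)

  U≡embed : ∀ t → U t ≡ embed (Uᶻ t)
  U≡embed t = sym (embed-polyᶻ (termsU t))

  W≡embed : ∀ t → W t ≡ embed (Wᶻ t)
  W≡embed t = sym (embed-polyᶻ (termsW t))

  quadratic : ℤ → ℤ → ℤ → ℤ → ℤ
  quadratic a b c x = a * (x * x) + b * x + c

  B-U B-W : ℤ → ℤ
  B-U α = α ^ 7 - α ^ 6 + α ^ 5 - + 3 * α ^ 4 + + 3 * α ^ 3 - α ^ 2 + α - 1ℤ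
  B-W α = - α ^ 7 + α ^ 6 - α ^ 5 - α ^ 4 + α ^ 3 + α ^ 2 - α + 1ℤ

  U-quadratic W-quadratic : ℤ → ℤ → ℤ
  U-quadratic α = quadratic (+ 2 * α ^ 7) (B-U α) -[1+ 1 ]
  W-quadratic α = quadratic (+ 2 * α ^ 7) (B-W α) -[1+ 1 ]

  ^-2t∸1 : ∀ α s → α ^ (2 ℕ.* (4 ℕ.+ s) ∸ 1) ≡ α ^ 7 * (α ^ s * α ^ s)
  ^-2t∸1 α s = begin
    α ^ (2 ℕ.* (4 ℕ.+ s) ∸ 1)   ≡⟨ cong (α ^_) (exponent s) ⟩
    α ^ (7 ℕ.+ (s ℕ.+ s))       ≡⟨ ℤP.^-distribˡ-+-* α 7 (s ℕ.+ s) ⟩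
    α ^ 7 * α ^ (s ℕ.+ s)       ≡⟨ cong (α ^ 7 *_) (ℤP.^-distribˡ-+-* α s s) ⟩
    α ^ 7 * (α ^ s * α ^ s)     ∎
    where
    open ≡-Reasoning
    exponent : ∀ s → 3 ℕ.+ (s ℕ.+ (4 ℕ.+ (s ℕ.+ 0))) ≡ 7 ℕ.+ (s ℕ.+ s)
    exponent = ℕ-Solver.solve-∀

  ^-t+ : ∀ α s e → α ^ (4 ℕ.+ s ℕ.+ e) ≡ α ^ (4 ℕ.+ e) * α ^ s
  ^-t+ α s e = trans (cong (λ n → α ^ (4 ℕ.+ n)) (ℕP.+-comm s e)) (ℤP.^-distribˡ-+-* α (4 ℕ.+ e) s)

  -- The rewrites bring every term to the form c·αᵏ·αˢ (for α^(t∸3) = α·αˢ and α^(t∸4) = αˢ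
  -- this holds definitionally), so abstracting the powers of α leaves a ring identity.
  eval-U : ∀ α s → eval (Uᶻ (4 ℕ.+ s)) α ≡ U-quadratic α (α ^ s)
  eval-U α s
    rewrite eval-polyᶻ (termsU (4 ℕ.+ s)) α | ^-2t∸1 α s | ^-t+ α s 3 | ^-t+ α s 2 | ^-t+ α s 1
          | ℤP.^-distribˡ-+-* α 4 s | ℤP.^-distribˡ-+-* α 3 s | ℤP.^-distribˡ-+-* α 2 s =
    U-identity α (α ^ s) (α ^ 2) (α ^ 3) (α ^ 4) (α ^ 5) (α ^ 6) (α ^ 7)
    where
    U-identity : ∀ α β a₂ a₃ a₄ a₅ a₆ a₇ →
      + 2 * (a₇ * (β * β)) + (1ℤ * (a₇ * β) + (-1ℤ * (a₆ * β) + (1ℤ * (a₅ * β)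
      + (-[1+ 2 ] * (a₄ * β) + (+ 3 * (a₃ * β) + (-1ℤ * (a₂ * β)
      + (1ℤ * (α * β) + (-1ℤ * β + (-[1+ 1 ] * 1ℤ + 0ℤ)))))))))
      ≡ + 2 * a₇ * (β * β) + (a₇ - a₆ + a₅ - + 3 * a₄ + + 3 * a₃ - a₂ + α - 1ℤ) * β + -[1+ 1 ]
    U-identity = solve-∀

  eval-W : ∀ α s → eval (Wᶻ (4 ℕ.+ s)) α ≡ W-quadratic α (α ^ s)
  eval-W α s
    rewrite eval-polyᶻ (termsW (4 ℕ.+ s)) α | ^-2t∸1 α s | ^-t+ α s 3 | ^-t+ α s 2 | ^-t+ α s 1
          | ℤP.^-distribˡ-+-* α 4 s | ℤP.^-distribˡ-+-* α 3 s | ℤP.^-distribˡ-+-* α 2 s =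
    W-identity α (α ^ s) (α ^ 2) (α ^ 3) (α ^ 4) (α ^ 5) (α ^ 6) (α ^ 7)
    where
    W-identity : ∀ α β a₂ a₃ a₄ a₅ a₆ a₇ →
      + 2 * (a₇ * (β * β)) + (-1ℤ * (a₇ * β) + (1ℤ * (a₆ * β) + (-1ℤ * (a₅ * β)
      + (-1ℤ * (a₄ * β) + (1ℤ * (a₃ * β) + (1ℤ * (a₂ * β)
      + (-1ℤ * (α * β) + (1ℤ * β + (-[1+ 1 ] * 1ℤ + 0ℤ)))))))))
      ≡ + 2 * a₇ * (β * β) + (- a₇ + a₆ - a₅ - a₄ + a₃ + a₂ - α + 1ℤ) * β + -[1+ 1 ]
    W-identity = solve-∀

module Congruences where

  open ClosedForms using (quadratic)
  open import Data.Integer using (_+_; _*_; _-_; _^_)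
  open import Data.Integer.Divisibility.Signed
    using (_∣_; divides; ∣m∣n⇒∣m+n; ∣n⇒∣m*n; ∣m⇒∣m*n; ∣m+n∣n⇒∣m)
  open import Data.Integer.Tactic.RingSolver using (solve-∀)

  ∣x-1⇒∣xⁿ-1 : ∀ {p x} n → p ∣ x - 1ℤ → p ∣ x ^ n - 1ℤ
  ∣x-1⇒∣xⁿ-1 {p} zero    _ = divides 0ℤ (sym (ℤP.*-zeroˡ p))
  ∣x-1⇒∣xⁿ-1 {p} {x} (suc n) p∣x-1 =
    subst (p ∣_) (lemma x (x ^ n)) (∣m∣n⇒∣m+n (∣n⇒∣m*n x (∣x-1⇒∣xⁿ-1 n p∣x-1)) p∣x-1)
    where
    lemma : ∀ x y → x * (y - 1ℤ) + (x - 1ℤ) ≡ x * y - 1ℤ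
    lemma = solve-∀

  ∣αᵐ-1⇒∣αʳ⁺ᵐᑫ-αʳ : ∀ {p α} m r q → p ∣ α ^ m - 1ℤ → p ∣ α ^ (r ℕ.+ m ℕ.* q) - α ^ r
  ∣αᵐ-1⇒∣αʳ⁺ᵐᑫ-αʳ {p} {α} m r q p∣αᵐ-1 =
    subst (p ∣_) (sym factorise) (∣n⇒∣m*n (α ^ r) (∣x-1⇒∣xⁿ-1 q p∣αᵐ-1))
    where
    open ≡-Reasoning
    factorise : α ^ (r ℕ.+ m ℕ.* q) - α ^ r ≡ α ^ r * ((α ^ m) ^ q - 1ℤ)
    factorise = begin
      α ^ (r ℕ.+ m ℕ.* q) - α ^ r       ≡⟨ cong (_- α ^ r) (ℤP.^-distribˡ-+-* α r (m ℕ.* q)) ⟩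
      α ^ r * α ^ (m ℕ.* q) - α ^ r     ≡⟨ cong (λ x → α ^ r * x - α ^ r) (ℤP.^-*-assoc α m q) ⟨
      α ^ r * (α ^ m) ^ q - α ^ r       ≡⟨ lemma (α ^ r) ((α ^ m) ^ q) ⟩
      α ^ r * ((α ^ m) ^ q - 1ℤ)        ∎
      where
      lemma : ∀ a b → a * b - a ≡ a * (b - 1ℤ)
      lemma = solve-∀

  quadratic-cong : ∀ {p} a b c {x y} → p ∣ x - y → p ∣ quadratic a b c x → p ∣ quadratic a b c y
  quadratic-cong {p} a b c {x} {y} p∣x-y p∣qx =
    ∣m+n∣n⇒∣m (subst (p ∣_) (difference a b c x y) p∣qx) (∣m⇒∣m*n (a * (x + y) + b) p∣x-y)
    where
    difference : ∀ a b c x y →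
      a * (x * x) + b * x + c ≡ a * (y * y) + b * y + c + (x - y) * (a * (x + y) + b)
    difference = solve-∀

module Certificates where

  open IntegerPolynomials
  open ClosedForms
  open Congruences
  open import Data.Nat using (_<_; NonZero)
  open import Data.Nat.DivMod using (_%_; _/_; m%n<n; m≡m%n+[m/n]*n)
  open import Data.Integer using (_*_; _-_; _^_)
  open import Data.Integer.Divisibility.Signed using (_∣_; _∣?_)
  open import Data.Nat.Properties using (allUpTo?)
  open import Data.List using (drop)
  open import Data.List.Properties using (≡-dec)
  open import Relation.Nullary using (¬_; ¬?)
  open import Relation.Nullary.Decidable using (True; toWitness)
  open import Function using (_∘_)
  import Data.Nat.Tactic.RingSolver as ℕ-Solver

  record Certificate (b : ℕ) : Set where
    field
      p α : ℤ
      Φ′ : List ℤ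
      Φ≡embed : Φ b ≡ embed (1ℤ ∷ Φ′)
      p∣Φ[α] : p ∣ eval (1ℤ ∷ Φ′) α
      p∣αᵇ-1 : p ∣ α ^ b - 1ℤ
      p∤U : ∀ {r} → r < b → ¬ p ∣ U-quadratic α (α ^ (r ℕ.* 2))
      p∤W : ∀ {r} → r < b → ¬ p ∣ W-quadratic α (α ^ (r ℕ.* 2))

  module _ {b} .{{_ : NonZero b}} (cert : Certificate b) (k : ℕ) where

    open Certificate cert

    p∣αᵏ-α^[k%b] : p ∣ α ^ (k ℕ.* 2) - α ^ (k % b ℕ.* 2)
    p∣αᵏ-α^[k%b] = subst (λ n → p ∣ α ^ n - α ^ (k % b ℕ.* 2)) (sym exponent)
      (∣αᵐ-1⇒∣αʳ⁺ᵐᑫ-αʳ b (k % b ℕ.* 2) (k / b ℕ.* 2) p∣αᵇ-1)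
      where
      exponent : k ℕ.* 2 ≡ k % b ℕ.* 2 ℕ.+ b ℕ.* (k / b ℕ.* 2)
      exponent = trans (cong (ℕ._* 2) (m≡m%n+[m/n]*n k b)) (lemma (k % b) (k / b) b)
        where
        lemma : ∀ r q b → (r ℕ.+ q ℕ.* b) ℕ.* 2 ≡ r ℕ.* 2 ℕ.+ b ℕ.* (q ℕ.* 2)
        lemma = ℕ-Solver.solve-∀

    t : ℕ
    t = 4 ℕ.+ k ℕ.* 2

    Φ∣ₚ⇒p∣eval : ∀ Q → Φ b ∣ₚ embed Q → p ∣ eval Q α
    Φ∣ₚ⇒p∣eval Q = ∣ₚ⇒∣eval Φ′ Q p∣Φ[α] ∘ subst (_∣ₚ embed Q) Φ≡embed

    certificate⇒¬Φ∣ₚU : ¬ Φ b ∣ₚ U t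
    certificate⇒¬Φ∣ₚU Φ∣U =
      p∤U (m%n<n k b) (quadratic-cong (+ 2 * α ^ 7) (B-U α) -[1+ 1 ] p∣αᵏ-α^[k%b] p∣U[α])
      where
      p∣U[α] : p ∣ U-quadratic α (α ^ (k ℕ.* 2))
      p∣U[α] = subst (p ∣_) (eval-U α (k ℕ.* 2))
        (Φ∣ₚ⇒p∣eval (Uᶻ t) (subst (Φ b ∣ₚ_) (U≡embed t) Φ∣U))

    certificate⇒¬Φ∣ₚW : ¬ Φ b ∣ₚ W t
    certificate⇒¬Φ∣ₚW Φ∣W =
      p∤W (m%n<n k b) (quadratic-cong (+ 2 * α ^ 7) (B-W α) -[1+ 1 ] p∣αᵏ-α^[k%b] p∣W[α])
      where
      p∣W[α] : p ∣ W-quadratic α (α ^ (k ℕ.* 2))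
      p∣W[α] = subst (p ∣_) (eval-W α (k ℕ.* 2))
        (Φ∣ₚ⇒p∣eval (Wᶻ t) (subst (Φ b ∣ₚ_) (W≡embed t) Φ∣W))

  certify : ∀ b p α → let Φ′ = map ℚ.↥_ (drop 1 (Φ b)) in
    {True (≡-dec ℚP._≟_ (Φ b) (embed (1ℤ ∷ Φ′)))} →
    {True (p ∣? eval (1ℤ ∷ Φ′) α)} →
    {True (p ∣? α ^ b - 1ℤ)} →
    {True (allUpTo? (λ r → ¬? (p ∣? U-quadratic α (α ^ (r ℕ.* 2)))) b)} →
    {True (allUpTo? (λ r → ¬? (p ∣? W-quadratic α (α ^ (r ℕ.* 2)))) b)} →
    Certificate b
  certify b p α {Φ≡} {p∣Φ} {p∣αᵇ} {p∤U} {p∤W} = record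
    { p = p
    ; α = α
    ; Φ′ = map ℚ.↥_ (drop 1 (Φ b))
    ; Φ≡embed = toWitness Φ≡
    ; p∣Φ[α] = toWitness p∣Φ
    ; p∣αᵇ-1 = toWitness p∣αᵇ
    ; p∤U = toWitness p∤U
    ; p∤W = toWitness p∤W
    }

module Divisors where

  open import Data.Nat using (_≤_; _<_; _≤?_; _*_; s≤s; NonZero)
  open import Data.Nat.Properties using (allUpTo?)
  open import Data.Nat.Divisibility using (_∣_; _∣?_; ∣-trans; ∣-reflexive; m∣m*n; n∣m*n; ∣⇒≤; 1∣_)
  open import Data.Nat.Primality using (Prime)
  open import Data.Nat.Primality.Factorisation using (factorise; PrimeFactorisation)
  open import Data.Nat.ListAction using (product)
  open import Data.List.Relation.Unary.All using (All; []; _∷_)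
  open import Data.List.Membership.Propositional using (_∈_)
  open import Data.List.Membership.DecPropositional ℕ._≟_ using (_∈?_)
  open import Data.Sum using (_⊎_; inj₁; inj₂)
  open import Data.Empty using (⊥-elim)
  open import Relation.Nullary using (¬_; ¬?; Dec)
  open import Relation.Nullary.Decidable using (from-yes; _×-dec_; _⊎-dec_; _→-dec_)

  Extends : ℕ → ℕ → ℕ → Set
  Extends q s d = q * d ∣ 3150 ⊎ s ∣ q * d

  extend : ∀ q s {d b} → Extends q s d → q * d ∣ b → ¬ s ∣ b → q * d ∣ 3150
  extend _ _ (inj₁ qd∣3150) _    _    = qd∣3150
  extend _ _ (inj₂ s∣qd)    qd∣b ¬s∣b = ⊥-elim (¬s∣b (∣-trans s∣qd qd∣b))

  Extends-all : ℕ → Set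
  Extends-all d = Extends 2 4 d × Extends 3 27 d × Extends 5 125 d × Extends 7 49 d

  divisors-of-3150-extend : ∀ {d} → d < 3151 → d ∣ 3150 → Extends-all d
  divisors-of-3150-extend = from-yes (allUpTo? (λ d → d ∣? 3150 →-dec
    (extends? 2 4 d ×-dec extends? 3 27 d ×-dec extends? 5 125 d ×-dec extends? 7 49 d)) 3151)
    where
    extends? : ∀ q s d → Dec (Extends q s d)
    extends? q s d = (q * d ∣? 3150) ⊎-dec (s ∣? q * d)

  smooth⇒∣3150 : ∀ {b} .{{_ : NonZero b}} →
    (∀ p → Prime p → p ∣ b → p ≡ 2 ⊎ p ≡ 3 ⊎ p ≡ 5 ⊎ p ≡ 7) →
    ¬ 4 ∣ b → ¬ 27 ∣ b → ¬ 125 ∣ b → ¬ 49 ∣ b → b ∣ 3150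
  smooth⇒∣3150 {b} smooth ¬4∣b ¬27∣b ¬125∣b ¬49∣b =
    subst (_∣ 3150) (sym isFactorisation)
      (go factors factorsPrime (∣-reflexive (sym isFactorisation)))
    where
    open PrimeFactorisation (factorise b)
    step : ∀ {q d} → q ≡ 2 ⊎ q ≡ 3 ⊎ q ≡ 5 ⊎ q ≡ 7 → Extends-all d → q * d ∣ b → q * d ∣ 3150
    step {d = d} (inj₁ refl)               (e , _ , _ , _) qd∣b = extend 2 4 {d} e qd∣b ¬4∣b
    step {d = d} (inj₂ (inj₁ refl))        (_ , e , _ , _) qd∣b = extend 3 27 {d} e qd∣b ¬27∣b
    step {d = d} (inj₂ (inj₂ (inj₁ refl))) (_ , _ , e , _) qd∣b = extend 5 125 {d} e qd∣b ¬125∣b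
    step {d = d} (inj₂ (inj₂ (inj₂ refl))) (_ , _ , _ , e) qd∣b = extend 7 49 {d} e qd∣b ¬49∣b
    go : ∀ ps → All Prime ps → product ps ∣ b → product ps ∣ 3150
    go []       []                   _    = 1∣ 3150
    go (q ∷ ps) (q-prime ∷ ps-prime) qd∣b = step
      (smooth q q-prime (∣-trans (m∣m*n (product ps)) qd∣b))
      (divisors-of-3150-extend (s≤s (∣⇒≤ d∣3150)) d∣3150)
      qd∣b
      where
      d∣3150 : product ps ∣ 3150
      d∣3150 = go ps ps-prime (∣-trans (n∣m*n q) qd∣b)

  admissible : List ℕ
  admissible = 3 ∷ 5 ∷ 6 ∷ 7 ∷ 9 ∷ 10 ∷ 14 ∷ 15 ∷ 18 ∷ 21 ∷ 25 ∷ 30 ∷ 35 ∷ 42 ∷ 45 ∷ 50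
             ∷ 63 ∷ 70 ∷ 75 ∷ 90 ∷ 126 ∷ 150 ∷ 175 ∷ 225 ∷ 350 ∷ 450 ∷ []

  divisors-of-3150-admissible : ∀ {b} → b < 3151 → b ∣ 3150 →
    3 ≤ b → ¬ (3 ∣ b × 5 ∣ b × 7 ∣ b) → b ∈ admissible
  divisors-of-3150-admissible = from-yes (allUpTo? (λ b → b ∣? 3150 →-dec 3 ≤? b →-dec
    ¬? (3 ∣? b ×-dec 5 ∣? b ×-dec 7 ∣? b) →-dec b ∈? admissible) 3151)

open Certificates
open Divisors using (admissible; divisors-of-3150-admissible; smooth⇒∣3150)
open import Data.List.Relation.Unary.All using (All; []; _∷_; lookup)

certificates : All Certificate admissible
certificates =
    certify 3 (+ 7) (+ 2)
  ∷ certify 5 (+ 11) (+ 3)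
  ∷ certify 6 (+ 7) (+ 3)
  ∷ certify 7 (+ 29) (+ 7)
  ∷ certify 9 (+ 19) (+ 4)
  ∷ certify 10 (+ 11) (+ 7)
  ∷ certify 14 (+ 29) (+ 4)
  ∷ certify 15 (+ 61) (+ 15)
  ∷ certify 18 (+ 19) (+ 3)
  ∷ certify 21 (+ 43) (+ 9)
  ∷ certify 25 (+ 101) (+ 16)
  ∷ certify 30 (+ 31) (+ 3)
  ∷ certify 35 (+ 71) (+ 4)
  ∷ certify 42 (+ 43) (+ 5)
  ∷ certify 45 (+ 181) (+ 9)
  ∷ certify 50 (+ 101) (+ 9)
  ∷ certify 63 (+ 127) (+ 36)
  ∷ certify 70 (+ 71) (+ 7)
  ∷ certify 75 (+ 151) (+ 11)
  ∷ certify 90 (+ 181) (+ 4)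
  ∷ certify 126 (+ 127) (+ 3)
  ∷ certify 150 (+ 151) (+ 7)
  ∷ certify 175 (+ 701) (+ 7)
  ∷ certify 225 (+ 1801) (+ 9)
  ∷ certify 350 (+ 701) (+ 4)
  ∷ certify 450 (+ 1801) (+ 3)
  ∷ []

open import Data.Nat using (_≤_; s≤s)
open import Data.Nat.Divisibility using (_∣_; divides; ∣⇒≤)
open import Data.Nat.Primality using (Prime)
open import Data.Sum using (_⊎_)
open import Relation.Nullary using (¬_)

lemma5p6 : (t : ℕ) → 2 ∣ t → 4 ≤ t →
    (b : ℕ) → 3 ≤ b →
    (∀ p → Prime p → p ∣ b → p ≡ 2 ⊎ p ≡ 3 ⊎ p ≡ 5 ⊎ p ≡ 7) →
    ¬ (3 ∣ b × 5 ∣ b × 7 ∣ b) →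
    ¬ (4 ∣ b) → ¬ (27 ∣ b) → ¬ (125 ∣ b) → ¬ (49 ∣ b) →
    ¬ (Φ b ∣ₚ U t) × ¬ (Φ b ∣ₚ W t)
lemma5p6 _ (divides 0 refl) ()
lemma5p6 _ (divides 1 refl) (s≤s (s≤s ()))
lemma5p6 _ (divides (suc (suc k)) refl) _ b@(suc _) 3≤b smooth ¬357 ¬4∣b ¬27∣b ¬125∣b ¬49∣b =
  certificate⇒¬Φ∣ₚU cert k , certificate⇒¬Φ∣ₚW cert k
  where
  b∣3150 : b ∣ 3150
  b∣3150 = smooth⇒∣3150 smooth ¬4∣b ¬27∣b ¬125∣b ¬49∣b
  cert : Certificate b
  cert = lookup certificates (divisors-of-3150-admissible (s≤s (∣⇒≤ b∣3150)) b∣3150 3≤b ¬357)
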